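{- Let $n\geq 3$ be an odd integer and let $\{F_0,\dots,F_{n-1}\}$ be the standard 1-factorisation on $\mathbb{Z}_n\cup\{\infty\}$. Suppose $S\subseteq\mathbb{Z}_n\cup\{\infty\}$ with $|S|>2$ induces a sub-1-factorisation $\mathcal{F}'$ of $\{F_0,\dots,F_{n-1}\}$. Then $S=\{\infty\}\cup C$ for some coset $C$ of a subgroup of $\mathbb{Z}_n$, and $\mathcal{F}'=\{F'_i: i\in C\}$, where $F'_i=\{\{x,y\}\in F_i: x,y\in S\}$ for each $i\in\mathbb{Z}_n$.
   Context: $\mathbb{Z}_n$ is the additive group of integers mod $n$, and $\infty$ is a new symbol. A 1-factor of a graph is a set of edges covering every vertex exactly once; a 1-factorisation on a set $V$ is a set of 1-factors of the complete graph on $V$ partitioning its edges. For odd $n\geq 3$, the standard 1-factorisation on $\mathbb{Z}_n\cup\{\infty\}$ is $\{F_0,\dots,F_{n-1}\}$ with $F_i=\{\{x,y\}: x,y\in\mathbb{Z}_n,\ x+y=2i\}\cup\{\{\infty,i\}\}$ (here $x\neq y$). If $\mathcal{F}$ is a 1-factorisation on $V$ and $\emptyset\neq S\subseteq V$, then $S$ induces a sub-1-factorisation $\mathcal{F}'$ of $\mathcal{F}$ if $\mathcal{F}'$ is a 1-factorisation on $S$ each of whose 1-factors is a subset of some 1-factor in $\mathcal{F}$. -}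

module Defs where

open import Data.Nat using (ℕ; _+_; _*_; NonZero)
open import Data.Nat.DivMod using (_%_; m%n<n)
open import Data.Fin using (Fin; toℕ; fromℕ<)
open import Data.Maybe using (Maybe; just; nothing)
open import Data.Product using (Σ; _×_; _,_; ∃-syntax)
open import Data.Sum using (_⊎_)
open import Data.Empty using (⊥)
open import Relation.Binary.PropositionalEquality using (_≡_; _≢_)
open import Function.Bundles using (_⇔_)

-- Vertex set ℤ_n ∪ {∞}; `nothing` is ∞, `just x` is x ∈ ℤ_n (ℤ_n = Fin n).
V : ℕ → Set
V n = Maybe (Fin n)

module _ {n : ℕ} .{{_ : NonZero n}} where
  0ₙ : Fin n
  0ₙ = fromℕ< (m%n<n 0 n)

  _+ₙ_ : Fin n → Fin n → Fin n
  a +ₙ b = fromℕ< (m%n<n (toℕ a + toℕ b) n)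

  -ₙ_ : Fin n → Fin n
  -ₙ a = fromℕ< (m%n<n (n Data.Nat.∸ toℕ a) n)

-- A (symmetric) edge set on V n: G x y means {x,y} ∈ G.
Graph : ℕ → Set₁
Graph n = V n → V n → Set

VSet : ℕ → Set₁
VSet n = V n → Set

MoreThanTwo : ∀ {n} → VSet n → Set
MoreThanTwo {n} S = ∃[ a ] ∃[ b ] ∃[ c ]
  (S a × S b × S c × a ≢ b × a ≢ c × b ≢ c)

IsOneFactorOn : ∀ {n} → VSet n → Graph n → Set
IsOneFactorOn {n} S F =
  (∀ x y → F x y → S x × S y × x ≢ y × F y x) ×
  (∀ x → S x → ∃[ y ] (F x y × (∀ z → F x z → z ≡ y)))

IsOneFactorisationOn : ∀ {n} → VSet n → (k : ℕ) → (Fin k → Graph n) → Set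
IsOneFactorisationOn {n} S k Φ =
  (∀ j → IsOneFactorOn S (Φ j)) ×
  (∀ x y → S x → S y → x ≢ y →
     ∃[ j ] (Φ j x y × (∀ j' → Φ j' x y → j' ≡ j)))

StdF : (n : ℕ) .{{_ : NonZero n}} → Fin n → Graph n
StdF n i (just x) (just y) = x ≢ y × (toℕ x + toℕ y) % n ≡ (2 * toℕ i) % n
StdF n i nothing  (just y) = y ≡ i
StdF n i (just x) nothing  = x ≡ i
StdF n i nothing  nothing  = ⊥

InducesSub1F : (n : ℕ) .{{_ : NonZero n}} → VSet n → (k : ℕ) → (Fin k → Graph n) → Set
InducesSub1F n S k Φ =
  IsOneFactorisationOn S k Φ ×
  (∀ j → ∃[ i ] (∀ x y → Φ j x y → StdF n i x y))

IsSubgroup : ∀ {n} .{{_ : NonZero n}} → (Fin n → Set) → Set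
IsSubgroup H =
  H 0ₙ × (∀ a b → H a → H b → H (a +ₙ b)) × (∀ a → H a → H (-ₙ a))

IsCoset : ∀ {n} .{{_ : NonZero n}} → (Fin n → Set) → Set₁
IsCoset {n} C = Σ (Fin n → Set) λ H → IsSubgroup H ×
  ∃[ a ] (∀ x → C x ⇔ (∃[ h ] (H h × x ≡ a +ₙ h)))

Restrict : (n : ℕ) .{{_ : NonZero n}} → VSet n → Fin n → Graph n
Restrict n S i x y = StdF n i x y × S x × S y

_≐_ : ∀ {n} → Graph n → Graph n → Set
G ≐ H = ∀ x y → G x y ⇔ H x y

module Submission where

-- Write C = {x ∈ ℤ_n : x ∈ S} for the finite part of S and,
-- for a factor Φ_j ⊆ F_i, call i its centre.  Within F_i a finite vertex x is
-- matched with its reflection 2i − x or (if x = i) with ∞; so the part of S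
-- that Φ_j matches inside ℤ_n is closed under reflection in the centre.
-- Composing two reflections gives a translation, and since n is odd,
-- iterating a translation by 2d exactly (n + 1)/2 times translates by d.
--   * ∞ ∈ S: given three finite points a, b, c, composing the reflections in
--     the centres of ab and ac translates by b − c; halving yields the
--     midpoint m of b and c in S, but m is its own reflection in the centre of
--     bc, so its partner in that factor can only be ∞.
--   * With ∞ ∈ S every i ∈ C is a centre (of the factor containing {∞, i}), so
--     C is closed under x ↦ x + (i − a) for a, i ∈ C, and is therefore a coset.
--     Each Φ_j equals F'_{centre j}, because F_i is a partial matching.

open import Defs
open import Data.Nat
open import Data.Nat.Properties
open import Data.Nat.DivMod
open import Data.Nat.Tactic.RingSolver using (solve-∀; solve)
open import Data.List using ([]; _∷_)
open import Algebra.Properties.CommutativeSemigroup +-commutativeSemigroup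
  using (x∙yz≈y∙xz; x∙yz≈y∙zx; x∙yz≈xz∙y; xy∙z≈xz∙y; xy∙z≈x∙zy)
open import Data.Maybe using (just; nothing)
open import Data.Product using (Σ; _×_; _,_; proj₁; proj₂; ∃-syntax)
open import Data.Sum using (_⊎_; inj₁; inj₂)
open import Data.Empty using (⊥; ⊥-elim)
open import Function.Bundles using (_⇔_; mk⇔)
open import Data.Fin using (Fin; toℕ; fromℕ<)
open import Data.Fin.Properties using (toℕ-injective; toℕ<n; toℕ-fromℕ<)
open import Relation.Binary.PropositionalEquality as ≡ using (_≡_; _≢_; refl; cong; subst)
open import Relation.Binary.Bundles using (Setoid)
import Relation.Binary.Construct.On as On
import Relation.Binary.Reasoning.Setoid as SetoidReasoning

module Modular (n : ℕ) .{{_ : NonZero n}} where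

  infix 4 _≈_
  _≈_ : ℕ → ℕ → Set
  a ≈ b = a % n ≡ b % n

  ≈-setoid : Setoid _ _
  ≈-setoid = On.setoid (≡.setoid ℕ) (_% n)

  open Setoid ≈-setoid public using () renaming (refl to ≈-refl; sym to ≈-sym; trans to ≈-trans)
  module ≈-Reasoning = SetoidReasoning ≈-setoid

  ≡⇒≈ : ∀ {a b} → a ≡ b → a ≈ b
  ≡⇒≈ = cong (_% n)

  +-cong : ∀ {a b c d} → a ≈ b → c ≈ d → a + c ≈ b + d
  +-cong {a} {b} {c} {d} a≈b c≈d = begin
    (a + c) % n         ≡⟨ %-distribˡ-+ a c n ⟩
    (a % n + c % n) % n ≡⟨ ≡.cong₂ (λ u v → (u + v) % n) a≈b c≈d ⟩
    (b % n + d % n) % n ≡⟨ %-distribˡ-+ b d n ⟨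
    (b + d) % n         ∎
    where open ≡.≡-Reasoning

  +-congˡ : ∀ c {a b} → a ≈ b → c + a ≈ c + b
  +-congˡ c = +-cong (≈-refl {c})

  +-congʳ : ∀ c {a b} → a ≈ b → a + c ≈ b + c
  +-congʳ c a≈b = +-cong a≈b (≈-refl {c})

  *-congˡ : ∀ k {a b} → a ≈ b → k * a ≈ k * b
  *-congˡ zero    a≈b = refl
  *-congˡ (suc k) a≈b = +-cong a≈b (*-congˡ k a≈b)

  +-multiple : ∀ a k → a + k * n ≈ a
  +-multiple a k = [m+kn]%n≡m%n a k n

  +-inverse : ∀ c → c + pred n * c ≈ 0
  +-inverse c = ≈-trans (≡⇒≈ (≡.trans (cong (_* c) (suc-pred n)) (*-comm n c))) (+-multiple 0 c)

  -- Addition modulo n is cancellative (add the inverse pred n * c).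
  +-cancelʳ : ∀ c {a b} → a + c ≈ b + c → a ≈ b
  +-cancelʳ c {a} {b} a+c≈b+c = begin
    a                       ≡⟨ +-identityʳ a ⟨
    a + 0                   ≈⟨ +-congˡ a (+-inverse c) ⟨
    a + (c + pred n * c)    ≡⟨ +-assoc a c _ ⟨
    a + c + pred n * c      ≈⟨ +-congʳ (pred n * c) a+c≈b+c ⟩
    b + c + pred n * c      ≡⟨ +-assoc b c _ ⟩
    b + (c + pred n * c)    ≈⟨ +-congˡ b (+-inverse c) ⟩
    b + 0                   ≡⟨ +-identityʳ b ⟩
    b                       ∎
    where open ≈-Reasoning

  +-cancelˡ : ∀ c {a b} → c + a ≈ c + b → a ≈ b
  +-cancelˡ c {a} {b} c+a≈c+b =
    +-cancelʳ c (≈-trans (≡⇒≈ (+-comm a c)) (≈-trans c+a≈c+b (≡⇒≈ (+-comm c b))))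

  double≡sum : ∀ a → 2 * a ≡ a + a
  double≡sum a = cong (a +_) (+-identityʳ a)

  halve : ∀ h → 2 * h ≡ n + 1 → ∀ a → h * (2 * a) ≈ a
  halve h 2h≡n+1 a = ≈-trans (≡⇒≈ (begin
    h * (2 * a)   ≡⟨ solve (h ∷ a ∷ []) ⟩
    (2 * h) * a   ≡⟨ cong (_* a) 2h≡n+1 ⟩
    (n + 1) * a   ≡⟨ solve (n ∷ a ∷ []) ⟩
    a + a * n     ∎)) (+-multiple a a)
    where open ≡.≡-Reasoning

  toℕ-injective-mod : ∀ {x y : Fin n} → toℕ x ≈ toℕ y → x ≡ y
  toℕ-injective-mod {x} {y} x≈y = toℕ-injective (begin
    toℕ x      ≡⟨ m<n⇒m%n≡m (toℕ<n x) ⟨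
    toℕ x % n  ≡⟨ x≈y ⟩
    toℕ y % n  ≡⟨ m<n⇒m%n≡m (toℕ<n y) ⟩
    toℕ y      ∎)
    where open ≡.≡-Reasoning

  toℕ-reduce : ∀ m → toℕ (fromℕ< (m%n<n m n)) ≈ m
  toℕ-reduce m = ≈-trans (≡⇒≈ (toℕ-fromℕ< (m%n<n m n))) (m%n%n≡m%n m n)

  toℕ-0ₙ : toℕ (0ₙ {n}) ≈ 0
  toℕ-0ₙ = toℕ-reduce 0

  toℕ-+ₙ : ∀ (a b : Fin n) → toℕ (a +ₙ b) ≈ toℕ a + toℕ b
  toℕ-+ₙ a b = toℕ-reduce (toℕ a + toℕ b)

  toℕ--ₙ : ∀ (a : Fin n) → toℕ a + toℕ (-ₙ a) ≈ 0
  toℕ--ₙ a = begin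
    toℕ a + toℕ (-ₙ a)  ≈⟨ +-congˡ (toℕ a) (toℕ-reduce (n ∸ toℕ a)) ⟩
    toℕ a + (n ∸ toℕ a) ≡⟨ m+[n∸m]≡n (<⇒≤ (toℕ<n a)) ⟩
    n                   ≡⟨ *-identityˡ n ⟨
    0 + 1 * n           ≈⟨ +-multiple 0 1 ⟩
    0                   ∎
    where open ≈-Reasoning

-- Subsets P of ℤ_n closed under reflections x ↦ s − x and translations
-- x ↦ x + (t − s), "unless Q": each closure step may instead produce a
-- witness of Q.
module Motions (n : ℕ) .{{_ : NonZero n}} {Q : Set} (P : Fin n → Set) where
  open Modular n

  ReflectionClosed : ℕ → Set
  ReflectionClosed s = ∀ x → P x → Q ⊎ ∃[ z ] (P z × toℕ x + toℕ z ≈ s)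

  TranslationClosed : ℕ → ℕ → Set
  TranslationClosed s t = ∀ x → P x → Q ⊎ ∃[ z ] (P z × toℕ z + s ≈ toℕ x + t)

  reflection-composite : ∀ {s t} → ReflectionClosed s → ReflectionClosed t →
    TranslationClosed s t
  reflection-composite {s} {t} reflect-s reflect-t x px with reflect-s x px
  ... | inj₁ q = inj₁ q
  ... | inj₂ (y , py , x+y≈s) with reflect-t y py
  ... | inj₁ q = inj₁ q
  ... | inj₂ (z , pz , y+z≈t) = inj₂ (z , pz , (begin
    Z + s        ≈⟨ +-congˡ Z x+y≈s ⟨
    Z + (X + Y)  ≡⟨ x∙yz≈y∙zx Z X Y ⟩
    X + (Y + Z)  ≈⟨ +-congˡ X y+z≈t ⟩
    X + t        ∎))
    where
    open ≈-Reasoning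
    X Y Z : ℕ
    X = toℕ x ; Y = toℕ y ; Z = toℕ z

  translation-composite : ∀ {s t s′ t′} → TranslationClosed s t →
    TranslationClosed s′ t′ → TranslationClosed (s + s′) (t + t′)
  translation-composite {s} {t} {s′} {t′} translate translate′ x px with translate x px
  ... | inj₁ q = inj₁ q
  ... | inj₂ (y , py , y+s≈x+t) with translate′ y py
  ... | inj₁ q = inj₁ q
  ... | inj₂ (z , pz , z+s′≈y+t′) = inj₂ (z , pz , (begin
    Z + (s + s′)   ≡⟨ x∙yz≈xz∙y Z s s′ ⟩
    (Z + s′) + s   ≈⟨ +-congʳ s z+s′≈y+t′ ⟩
    (Y + t′) + s   ≡⟨ xy∙z≈xz∙y Y t′ s ⟩
    (Y + s) + t′   ≈⟨ +-congʳ t′ y+s≈x+t ⟩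
    (X + t) + t′   ≡⟨ +-assoc X t t′ ⟩
    X + (t + t′)   ∎))
    where
    open ≈-Reasoning
    X Y Z : ℕ
    X = toℕ x ; Y = toℕ y ; Z = toℕ z

  translation-power : ∀ {s t} → TranslationClosed s t →
    ∀ m → TranslationClosed (m * s) (m * t)
  translation-power translate zero    x px = inj₂ (x , px , ≈-refl)
  translation-power translate (suc m) =
    translation-composite translate (translation-power translate m)

  translation-cong : ∀ {s t s′ t′} → s ≈ s′ → t ≈ t′ →
    TranslationClosed s t → TranslationClosed s′ t′
  translation-cong s≈s′ t≈t′ translate x px with translate x px
  ... | inj₁ q = inj₁ q
  ... | inj₂ (z , pz , z+s≈x+t) = inj₂ (z , pz ,
    ≈-trans (+-congˡ (toℕ z) (≈-sym s≈s′)) (≈-trans z+s≈x+t (+-congˡ (toℕ x) t≈t′)))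

  translation-cancel : ∀ u {s t} → TranslationClosed (u + s) (u + t) →
    TranslationClosed s t
  translation-cancel u {s} {t} translate x px with translate x px
  ... | inj₁ q = inj₁ q
  ... | inj₂ (z , pz , eq) = inj₂ (z , pz , +-cancelʳ u (begin
    toℕ z + s + u    ≡⟨ xy∙z≈x∙zy (toℕ z) s u ⟩
    toℕ z + (u + s)  ≈⟨ eq ⟩
    toℕ x + (u + t)  ≡⟨ xy∙z≈x∙zy (toℕ x) t u ⟨
    toℕ x + t + u    ∎))
    where open ≈-Reasoning

  -- For n odd, translation by 2d can be halved: iterate it (n + 1)/2 times.
  translation-halve : ∀ h → 2 * h ≡ n + 1 → ∀ {s t} →
    TranslationClosed (2 * s) (2 * t) → TranslationClosed s t
  translation-halve h 2h≡n+1 {s} {t} translate =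
    translation-cong (halve h 2h≡n+1 s) (halve h 2h≡n+1 t) (translation-power translate h)

  midpoint : ∀ h → 2 * h ≡ n + 1 → ∀ {s t} → TranslationClosed s t →
    ∀ x → P x → Q ⊎ ∃[ m ] (P m × toℕ m + toℕ m + s ≈ toℕ x + toℕ x + t)
  midpoint h 2h≡n+1 {s} {t} translate x px
    with translation-power translate h x px
  ... | inj₁ q = inj₁ q
  ... | inj₂ (m , pm , m+hs≈x+ht) = inj₂ (m , pm , (begin
    M + M + s            ≈⟨ +-congˡ (M + M) (halve h 2h≡n+1 s) ⟨
    M + M + h * (2 * s)  ≡⟨ double-shift M h s ⟩
    2 * (M + h * s)      ≈⟨ *-congˡ 2 m+hs≈x+ht ⟩
    2 * (X + h * t)      ≡⟨ double-shift X h t ⟨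
    X + X + h * (2 * t)  ≈⟨ +-congˡ (X + X) (halve h 2h≡n+1 t) ⟩
    X + X + t            ∎))
    where
    open ≈-Reasoning
    M X : ℕ
    M = toℕ m ; X = toℕ x
    double-shift : ∀ a b c → a + a + b * (2 * c) ≡ 2 * (a + b * c)
    double-shift = solve-∀

module Cosets (n : ℕ) .{{_ : NonZero n}} (C : Fin n → Set) where
  open Modular n
  open Motions n {⊥} C using (TranslationClosed)

  translation-closed⇒coset : ∀ a₀ → C a₀ →
    (∀ {a i} → C a → C i → TranslationClosed (toℕ a) (toℕ i)) → IsCoset C
  translation-closed⇒coset a₀ ca₀ translate =
    H , (H-0ₙ , H-+ₙ , H--ₙ) , a₀ , λ x → mk⇔
      (λ cx → x +ₙ (-ₙ a₀) , subst C (≡.sym (recentre x)) cx , ≡.sym (recentre x))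
      (λ { (_ , ch , refl) → ch })
    where
    A : ℕ
    A = toℕ a₀
    H : Fin n → Set
    H h = C (a₀ +ₙ h)

    move : ∀ {a i} → C a → C i → ∀ x → C x →
      ∃[ z ] (C z × toℕ z + toℕ a ≈ toℕ x + toℕ i)
    move ca ci x cx with translate ca ci x cx
    ... | inj₁ ()
    ... | inj₂ found = found

    into-H : ∀ {z} h → C z → toℕ z ≈ A + toℕ h → H h
    into-H {z} h cz z≈a₀+h =
      subst C (toℕ-injective-mod (≈-trans z≈a₀+h (≈-sym (toℕ-+ₙ a₀ h)))) cz

    -- H is a subgroup: 0 ∈ H, H + H ⊆ H (translate a₀ + h₁ by h₂) and
    -- −H ⊆ H (translate a₀ by −h).
    H-0ₙ : H 0ₙ
    H-0ₙ = into-H 0ₙ ca₀ (begin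
      A            ≡⟨ +-identityʳ A ⟨
      A + 0        ≈⟨ +-congˡ A toℕ-0ₙ ⟨
      A + toℕ 0ₙ   ∎)
      where open ≈-Reasoning

    H-+ₙ : ∀ h₁ h₂ → H h₁ → H h₂ → H (h₁ +ₙ h₂)
    H-+ₙ h₁ h₂ ch₁ ch₂ with move ca₀ ch₂ (a₀ +ₙ h₁) ch₁
    ... | z , cz , z+a₀≈ = into-H (h₁ +ₙ h₂) cz (+-cancelʳ A (begin
      toℕ z + A                              ≈⟨ z+a₀≈ ⟩
      toℕ (a₀ +ₙ h₁) + toℕ (a₀ +ₙ h₂)        ≈⟨ +-cong (toℕ-+ₙ a₀ h₁) (toℕ-+ₙ a₀ h₂) ⟩
      (A + H₁) + (A + H₂)                    ≡⟨ shuffle A H₁ H₂ ⟩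
      A + (H₁ + H₂) + A                      ≈⟨ +-congʳ A (+-congˡ A (toℕ-+ₙ h₁ h₂)) ⟨
      A + toℕ (h₁ +ₙ h₂) + A                 ∎))
      where
      open ≈-Reasoning
      H₁ H₂ : ℕ
      H₁ = toℕ h₁ ; H₂ = toℕ h₂
      shuffle : ∀ a b c → (a + b) + (a + c) ≡ a + (b + c) + a
      shuffle = solve-∀

    H--ₙ : ∀ h → H h → H (-ₙ h)
    H--ₙ h ch with move ch ca₀ a₀ ca₀
    ... | z , cz , z+a₀+h≈ = into-H (-ₙ h) cz (+-cancelʳ (A + Hh) (begin
      toℕ z + (A + Hh)              ≈⟨ +-congˡ (toℕ z) (toℕ-+ₙ a₀ h) ⟨
      toℕ z + toℕ (a₀ +ₙ h)         ≈⟨ z+a₀+h≈ ⟩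
      A + A                         ≡⟨ +-identityʳ (A + A) ⟨
      A + A + 0                     ≈⟨ +-congˡ (A + A) (toℕ--ₙ h) ⟨
      A + A + (Hh + toℕ (-ₙ h))     ≡⟨ shuffle A Hh (toℕ (-ₙ h)) ⟩
      A + toℕ (-ₙ h) + (A + Hh)     ∎))
      where
      open ≈-Reasoning
      Hh : ℕ
      Hh = toℕ h
      shuffle : ∀ a b c → a + a + (b + c) ≡ a + c + (a + b)
      shuffle = solve-∀

    recentre : ∀ x → a₀ +ₙ (x +ₙ (-ₙ a₀)) ≡ x
    recentre x = toℕ-injective-mod (begin
      toℕ (a₀ +ₙ (x +ₙ (-ₙ a₀)))   ≈⟨ toℕ-+ₙ a₀ _ ⟩
      A + toℕ (x +ₙ (-ₙ a₀))       ≈⟨ +-congˡ A (toℕ-+ₙ x (-ₙ a₀)) ⟩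
      A + (toℕ x + toℕ (-ₙ a₀))    ≡⟨ x∙yz≈y∙xz A (toℕ x) _ ⟩
      toℕ x + (A + toℕ (-ₙ a₀))    ≈⟨ +-congˡ (toℕ x) (toℕ--ₙ a₀) ⟩
      toℕ x + 0                    ≡⟨ +-identityʳ (toℕ x) ⟩
      toℕ x                        ∎)
      where open ≈-Reasoning

-- Each standard 1-factor F_i is a partial matching: a vertex has at most one
-- partner in F_i.  (A finite x with a finite partner y ≠ x and also ∞ would
-- force x + y = 2x, i.e. y = x.)
module StandardFactor (n : ℕ) .{{_ : NonZero n}} where
  open Modular n

  private
    -- The centre i is matched only with ∞: its reflection in i is itself.
    no-fixed-partner : ∀ i {x y : Fin n} → x ≢ y →
      toℕ x + toℕ y ≈ 2 * toℕ i → x ≡ i → ⊥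
    no-fixed-partner i {x} {y} x≢y x+y≈2i refl = x≢y (≡.sym (toℕ-injective-mod
      (+-cancelˡ (toℕ x) (≈-trans x+y≈2i (≡⇒≈ (double≡sum (toℕ x)))))))

  StdF-functional : ∀ i {x y w} → StdF n i x y → StdF n i x w → y ≡ w
  StdF-functional i {nothing}  {just y} {just w} refl refl = refl
  StdF-functional i {just x}   {nothing} {nothing} _ _     = refl
  StdF-functional i {just x}   {nothing} {just w} x≡i (x≢w , x+w≈2i) =
    ⊥-elim (no-fixed-partner i x≢w x+w≈2i x≡i)
  StdF-functional i {just x}   {just y} {nothing} (x≢y , x+y≈2i) x≡i =
    ⊥-elim (no-fixed-partner i x≢y x+y≈2i x≡i)
  StdF-functional i {just x}   {just y} {just w} (_ , x+y≈2i) (_ , x+w≈2i) =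
    cong just (toℕ-injective-mod (+-cancelˡ (toℕ x) (≈-trans x+y≈2i (≈-sym x+w≈2i))))

module SubFactorisation (n : ℕ) .{{_ : NonZero n}} (S : VSet n)
  (k : ℕ) (Φ : Fin k → Graph n) (induces : InducesSub1F n S k Φ) where
  open Modular n
  open StandardFactor n

  centre : Fin k → Fin n
  centre j = proj₁ (proj₂ induces j)

  Φ⊆F : ∀ j {x y} → Φ j x y → StdF n (centre j) x y
  Φ⊆F j = proj₂ (proj₂ induces j) _ _

  edge-in-S : ∀ j {x y} → Φ j x y → S x × S y × x ≢ y
  edge-in-S j {x} {y} φ with proj₁ (proj₁ (proj₁ induces) j) x y φ
  ... | sx , sy , x≢y , _ = sx , sy , x≢y

  partner : ∀ j {x} → S x → ∃[ y ] Φ j x y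
  partner j {x} sx with proj₂ (proj₁ (proj₁ induces) j) x sx
  ... | y , φ , _ = y , φ

  factor-containing : ∀ {x y} → S x → S y → x ≢ y → ∃[ j ] Φ j x y
  factor-containing sx sy x≢y with proj₂ (proj₁ induces) _ _ sx sy x≢y
  ... | j , φ , _ = j , φ

  partner-of-finite : ∀ j {x} → S (just x) →
    (S nothing × x ≡ centre j) ⊎
    ∃[ z ] (S (just z) × x ≢ z × toℕ x + toℕ z ≈ 2 * toℕ (centre j))
  partner-of-finite j sx with partner j sx
  ... | nothing , φ = inj₁ (proj₁ (proj₂ (edge-in-S j φ)) , Φ⊆F j φ)
  ... | just z  , φ with edge-in-S j φ
  ...   | _ , sz , x≢z = inj₂ (z , sz , (λ x≡z → x≢z (cong just x≡z)) , proj₂ (Φ⊆F j φ))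

  edge-centre : ∀ {x y} → S (just x) → S (just y) → x ≢ y →
    ∃[ j ] (toℕ x + toℕ y ≈ 2 * toℕ (centre j))
  edge-centre sx sy x≢y with factor-containing sx sy (λ { refl → x≢y refl })
  ... | j , φ = j , proj₂ (Φ⊆F j φ)

  -- Each Φ_j is the restriction of F_{centre j} to S: a vertex of S has a
  -- partner in Φ_j, which is its unique partner in F_{centre j}.
  factor≐restriction : ∀ j → Φ j ≐ Restrict n S (centre j)
  factor≐restriction j x y = mk⇔
    (λ φ → Φ⊆F j φ , proj₁ (edge-in-S j φ) , proj₁ (proj₂ (edge-in-S j φ)))
    (λ { (xy∈F , sx , _) → let (w , φ) = partner j sx in
         subst (Φ j x) (≡.sym (StdF-functional (centre j) xy∈F (Φ⊆F j φ))) φ })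

  -- Three finite points a, b, c of S force ∞ ∈ S.  Otherwise the finite part
  -- of S is closed under reflection in every centre, hence under translation
  -- by b − c (reflect in the centres of ac and ab), hence (n odd) contains the
  -- midpoint m of b and c; but m is its own reflection in the centre of bc,
  -- so its partner in that factor must be ∞.
  ∞-from-three-finite : ∀ h → 2 * h ≡ n + 1 → ∀ {a b c} →
    S (just a) → S (just b) → S (just c) → a ≢ b → a ≢ c → b ≢ c → S nothing
  ∞-from-three-finite h 2h≡n+1 {a} {b} {c} sa sb sc a≢b a≢c b≢c =
    from-midpoint (midpoint h 2h≡n+1 translate-by-b−c c sc)
    where
    open Motions n {S nothing} (λ x → S (just x))
    A B C : ℕ
    A = toℕ a ; B = toℕ b ; C = toℕ c

    reflect-in : ∀ j → ReflectionClosed (2 * toℕ (centre j))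
    reflect-in j x sx with partner-of-finite j sx
    ... | inj₁ (∞∈S , _)           = inj₁ ∞∈S
    ... | inj₂ (z , sz , _ , x+z≈) = inj₂ (z , sz , x+z≈)

    ab : ∃[ j ] (A + B ≈ 2 * toℕ (centre j))
    ab = edge-centre sa sb a≢b
    ac : ∃[ j ] (A + C ≈ 2 * toℕ (centre j))
    ac = edge-centre sa sc a≢c
    bc : ∃[ j ] (B + C ≈ 2 * toℕ (centre j))
    bc = edge-centre sb sc b≢c

    translate-by-b−c : TranslationClosed C B
    translate-by-b−c = translation-cancel A
      (translation-cong (≈-sym (proj₂ ac)) (≈-sym (proj₂ ab))
        (reflection-composite (reflect-in (proj₁ ac)) (reflect-in (proj₁ ab))))

    -- A finite partner y of the midpoint m would satisfy m + y = b + c = 2m.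
    from-midpoint : S nothing ⊎
      ∃[ m ] (S (just m) × toℕ m + toℕ m + C ≈ C + C + B) → S nothing
    from-midpoint (inj₁ ∞∈S) = ∞∈S
    from-midpoint (inj₂ (m , sm , mm+c≈cc+b)) with partner-of-finite (proj₁ bc) sm
    ... | inj₁ (∞∈S , _) = ∞∈S
    ... | inj₂ (y , _ , m≢y , m+y≈centre) =
      ⊥-elim (m≢y (toℕ-injective-mod (+-cancelˡ M (begin
        M + M                       ≈⟨ +-cancelʳ C (≈-trans mm+c≈cc+b (≡⇒≈ (swap C B))) ⟩
        B + C                       ≈⟨ proj₂ bc ⟩
        2 * toℕ (centre (proj₁ bc)) ≈⟨ m+y≈centre ⟨
        M + toℕ y                   ∎))))
      where
      open ≈-Reasoning
      M : ℕ
      M = toℕ m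
      swap : ∀ c b → c + c + b ≡ b + c + c
      swap = solve-∀

  ∞∈S : ∀ h → 2 * h ≡ n + 1 → MoreThanTwo S → S nothing
  ∞∈S _ _ (nothing , _ , _ , sa , _) = sa
  ∞∈S _ _ (just _ , nothing , _ , _ , sb , _) = sb
  ∞∈S _ _ (just _ , just _ , nothing , _ , _ , sc , _) = sc
  ∞∈S h 2h≡n+1 (just _ , just _ , just _ , sa , sb , sc , a≢b , a≢c , b≢c) =
    ∞-from-three-finite h 2h≡n+1 sa sb sc
      (λ { refl → a≢b refl }) (λ { refl → a≢c refl }) (λ { refl → b≢c refl })

  module WithInfinity (h : ℕ) (2h≡n+1 : 2 * h ≡ n + 1) (∞∈S : S nothing) where

    C : Fin n → Set
    C x = S (just x)

    open Motions n {⊥} C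

    -- ∞ is matched in Φ_j with centre j, which therefore lies in C.
    centre∈C : ∀ j → C (centre j)
    centre∈C j with partner j ∞∈S
    ... | nothing , φ = ⊥-elim (Φ⊆F j φ)
    ... | just y  , φ = subst C (Φ⊆F j φ) (proj₁ (proj₂ (edge-in-S j φ)))

    -- Each i ∈ C is a centre: that of the factor containing the edge {∞, i}.
    factor-centred-at : ∀ {i} → C i → ∃[ j ] (centre j ≡ i)
    factor-centred-at ci with factor-containing ∞∈S ci (λ ())
    ... | j , φ = j , ≡.sym (Φ⊆F j φ)

    reflect-in : ∀ {i} → C i → ReflectionClosed (2 * toℕ i)
    reflect-in ci x cx with factor-centred-at ci
    ... | j , refl with partner-of-finite j cx
    ...   | inj₁ (_ , refl)             = inj₂ (x , cx , ≡⇒≈ (≡.sym (double≡sum (toℕ x))))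
    ...   | inj₂ (z , cz , _ , x+z≈2i)  = inj₂ (z , cz , x+z≈2i)

    -- Composing the reflections in a and i translates by 2(i − a); halve it.
    translate : ∀ {a i} → C a → C i → TranslationClosed (toℕ a) (toℕ i)
    translate ca ci =
      translation-halve h 2h≡n+1 (reflection-composite (reflect-in ca) (reflect-in ci))

    C-is-coset : ∀ {a₀} → C a₀ → IsCoset C
    C-is-coset {a₀} ca₀ = Cosets.translation-closed⇒coset n C a₀ ca₀ translate

    S≡∞∪C : ∀ v → S v ⇔ (v ≡ nothing ⊎ ∃[ x ] (v ≡ just x × C x))
    S≡∞∪C nothing  = mk⇔ (λ _ → inj₁ refl) (λ _ → ∞∈S)
    S≡∞∪C (just x) = mk⇔ (λ cx → inj₂ (x , refl , cx))
                         (λ { (inj₂ (_ , refl , cx)) → cx })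

odd⇒half : ∀ n → n % 2 ≡ 1 → ∃[ h ] (2 * h ≡ n + 1)
odd⇒half n n%2≡1 = suc (n / 2) , (begin
  2 * suc (n / 2)        ≡⟨ rearrange (n / 2) ⟩
  1 + n / 2 * 2 + 1      ≡⟨ cong (λ r → r + n / 2 * 2 + 1) n%2≡1 ⟨
  n % 2 + n / 2 * 2 + 1  ≡⟨ cong (_+ 1) (m≡m%n+[m/n]*n n 2) ⟨
  n + 1                  ∎)
  where
  open ≡.≡-Reasoning
  rearrange : ∀ q → 2 * suc q ≡ 1 + q * 2 + 1
  rearrange = solve-∀

lemma6 : (n : ℕ) .{{_ : NonZero n}} → 3 ≤ n → n % 2 ≡ 1 →
    (S : VSet n) → MoreThanTwo S →
    (k : ℕ) (Φ : Fin k → Graph n) → InducesSub1F n S k Φ →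
    Σ (Fin n → Set) λ C → IsCoset C ×
    (∀ v → S v ⇔ (v ≡ nothing ⊎ ∃[ x ] (v ≡ just x × C x))) ×
    (∀ j → ∃[ i ] (C i × Φ j ≐ Restrict n S i)) ×
    (∀ i → C i → ∃[ j ] (Φ j ≐ Restrict n S i))
lemma6 n _ n%2≡1 S three@(_ , _ , _ , sa , sb , _ , a≢b , _) k Φ induces =
  C , C-is-coset (centre∈C j₀) , S≡∞∪C ,
  (λ j → centre j , centre∈C j , factor≐restriction j) ,
  λ i ci → let (j , centre-j≡i) = factor-centred-at ci in
    j , subst (λ i → Φ j ≐ Restrict n S i) centre-j≡i (factor≐restriction j)
  where
  h : ℕ
  h = proj₁ (odd⇒half n n%2≡1)
  2h≡n+1 : 2 * h ≡ n + 1
  2h≡n+1 = proj₂ (odd⇒half n n%2≡1)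
  open SubFactorisation n S k Φ induces
  open WithInfinity h 2h≡n+1 (∞∈S h 2h≡n+1 three)
  -- C is nonempty: it contains the centre of the factor through a and b.
  j₀ : Fin k
  j₀ = proj₁ (factor-containing sa sb a≢b)
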